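{- Let $k\ge 1$ and let $S=(s_1,s_2,\ldots)$ be a packing sequence with $s_1=k$. If $G$ is a graph with $\mathrm{diam}(G)=k$ and girth $g(G)\ge k+2$, then $G$ is $\chi_S$-critical.
   Context: All graphs are finite and simple; the girth of an acyclic graph is $\infty$. A packing sequence is an infinite non-decreasing sequence $S=(s_1,s_2,\ldots)$ of positive integers. A map $c:V(G)\to\{1,\ldots,m\}$ is an $S$-packing $m$-coloring if for distinct $u,v$, $c(u)=c(v)=i$ implies $d_G(u,v)>s_i$; $\chi_S(G)$ is the least such $m$. $G$ is $\chi_S$-critical if $\chi_S(H)<\chi_S(G)$ for every proper (nonempty) subgraph $H$ of $G$. -}

module Defs where

open import Data.Nat using (ℕ; zero; suc; _+_; _≤_; _<_; _≥_; NonZero; s≤s)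
open import Data.Nat.DivMod using (_%_; m%n<n)
open import Data.Fin using (Fin; toℕ; fromℕ<)
open import Data.Fin.Properties using ()

open import Data.Product using (Σ; ∃; ∃-syntax; _×_; _,_)
open import Data.Empty using (⊥)
open import Relation.Nullary using (¬_)
open import Relation.Binary.PropositionalEquality using (_≡_; _≢_)
open import Function.Definitions using (Injective; Surjective)

record Graph : Set₁ where
  field
    n      : ℕ
    Adj    : Fin n → Fin n → Set
    sym    : ∀ {u v} → Adj u v → Adj v u
    irrefl : ∀ {u} → ¬ Adj u u
open Graph public

data Walk (G : Graph) : ℕ → Fin (n G) → Fin (n G) → Set where
  here : ∀ {u} → Walk G zero u u
  step : ∀ {l u v w} → Adj G u v → Walk G l v w → Walk G (suc l) u w

-- d_G(u,v) ≤ s  (distance ∞ between different components is never ≤ s).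
DistLe : (G : Graph) → Fin (n G) → Fin (n G) → ℕ → Set
DistLe G u v s = ∃[ l ] (l ≤ s × Walk G l u v)

-- diam(G) = k : every pair is at distance ≤ k and some pair is at distance exactly k
-- (a disconnected graph has infinite diameter, so it never satisfies this).
DiamEq : Graph → ℕ → Set
DiamEq G k =
  (∀ u v → DistLe G u v k) ×
  ∃[ u ] ∃[ v ] (∀ s → DistLe G u v s → k ≤ s)

nz : ∀ {l} → 3 ≤ l → NonZero l
nz (s≤s _) = _

record Cycle (G : Graph) (l : ℕ) : Set where
  field
    len≥3 : 3 ≤ l
    vtx   : Fin l → Fin (n G)
    inj   : Injective _≡_ _≡_ vtx
    adj   : (i : Fin l) →
            Adj G (vtx i) (vtx (fromℕ< (m%n<n (suc (toℕ i)) l {{nz len≥3}})))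

-- girth(G) ≥ g : every cycle has length ≥ g (acyclic graphs have girth ∞).
GirthGe : Graph → ℕ → Set
GirthGe G g = ∀ l → Cycle G l → g ≤ l

-- A packing sequence, indexed from 0 in Agda: s 0 = s_1, s 1 = s_2, …
record PackingSeq : Set where
  field
    s        : ℕ → ℕ
    positive : ∀ i → 1 ≤ s i
    mono     : ∀ i → s i ≤ s (suc i)
open PackingSeq public

-- c : V(G) → {1,…,m} is encoded as c : Fin (n G) → Fin m, colour j ∈ Fin m
-- standing for colour toℕ j + 1, whose constraint is s_{toℕ j + 1} = s S (toℕ j).
IsPacking : PackingSeq → (G : Graph) → (m : ℕ) → (Fin (n G) → Fin m) → Set
IsPacking S G m c =
  ∀ u v → u ≢ v → c u ≡ c v → ¬ DistLe G u v (s S (toℕ (c u)))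

HasPacking : PackingSeq → Graph → ℕ → Set
HasPacking S G m = Σ (Fin (n G) → Fin m) (IsPacking S G m)

ChiS : PackingSeq → Graph → ℕ → Set
ChiS S G m = HasPacking S G m × (∀ m' → m' < m → ¬ HasPacking S G m')

-- H is (isomorphic to) a subgraph of G via an injective vertex map φ
-- preserving adjacency; it is proper unless φ is bijective and reflects
-- adjacency (i.e. H = G).
record ProperSubgraph (H G : Graph) : Set where
  field
    φ        : Fin (n H) → Fin (n G)
    φ-inj    : Injective _≡_ _≡_ φ
    φ-hom    : ∀ {u v} → Adj H u v → Adj G (φ u) (φ v)
    proper   : ¬ (Surjective _≡_ _≡_ φ × (∀ u v → Adj G (φ u) (φ v) → Adj H u v))

Critical : PackingSeq → Graph → Set₁
Critical S G =
  ∀ (H : Graph) → ProperSubgraph H G → 1 ≤ n H →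
  ∀ mG mH → ChiS S G mG → ChiS S H mH → mH < mG

-- Since diam(G) ≤ k = s₁ ≤ sᵢ, any two vertices of G are too close to share a colour, so
-- χ_S(G) = |V(G)|. A proper subgraph H with fewer vertices is coloured injectively with
-- fewer colours. Otherwise H lacks some edge uv of G; a u–v path in H of length ≤ k would
-- close with uv to a cycle of G of length ≤ k + 1 < girth, so d_H(u,v) > s₁ and u, v may
-- share colour 1, whence χ_S(H) ≤ |V(G)| − 1.

module Submission where

open import Defs
open import Data.Nat using (ℕ; _+_; _≤_)
open import Relation.Binary.PropositionalEquality using (_≡_)

open import Data.Nat.Base using (zero; suc; pred; _<_; z≤n; s≤s)
open import Data.Nat.Properties
  using (≤-refl; ≤-trans; <-≤-trans; m≤n⇒m≤1+n; <⇒≱; ≮⇒≥; ≤-antisym;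
         ≤-pred; suc-injective; +-comm; 1+n≰n; _<?_; m≤pred[n]⇒suc[m]≤n)
open import Data.Nat.DivMod using (_%_; m%n<n; m<n⇒m%n≡m; n%n≡0)
open import Data.Fin.Base using (Fin; toℕ; fromℕ<; punchOut)
  renaming (zero to fzero; suc to fsuc)
open import Data.Fin.Properties
  using (_≟_; toℕ-fromℕ<; toℕ<n; punchOut-injective; injective⇒≤;
         any?; nonZeroIndex)
open import Data.Fin.Permutation.Components using (transpose; transpose-inverse)
open import Data.Product using (Σ; ∃-syntax; _×_; _,_)
open import Data.Sum using (_⊎_; inj₁; inj₂)
open import Data.Empty using (⊥; ⊥-elim)
open import Data.Unit using (⊤; tt)
open import Relation.Nullary using (¬_; Dec; yes; no)
open import Relation.Nullary.Decidable using (decidable-stable)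
open import Relation.Binary.PropositionalEquality using (refl; trans; cong; subst; _≢_) renaming (sym to ≡-sym)
open import Function.Definitions using (Injective; Surjective)
open import Function.Base using (_∘_)

module _ {G : Graph} where

  infix 4 _∈ᵥ_

  data _∈ᵥ_ (x : Fin (n G)) : ∀ {l u w} → Walk G l u w → Set where
    at-end   : x ∈ᵥ here {u = x}
    at-start : ∀ {l v w} {e : Adj G x v} {p : Walk G l v w} → x ∈ᵥ step e p
    further  : ∀ {l u v w} {e : Adj G u v} {p : Walk G l v w} → x ∈ᵥ p → x ∈ᵥ step e p

  _∈ᵥ?_ : ∀ x {l u w} (p : Walk G l u w) → Dec (x ∈ᵥ p)
  x ∈ᵥ? here {u} with x ≟ u
  ... | yes refl = yes at-end
  ... | no x≢u   = no λ { at-end → x≢u refl }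
  x ∈ᵥ? step {u = u} e p with x ≟ u | x ∈ᵥ? p
  ... | yes refl | _      = yes at-start
  ... | no _     | yes x∈p = yes (further x∈p)
  ... | no x≢u   | no x∉p  = no λ { at-start → x≢u refl ; (further x∈p) → x∉p x∈p }

  IsPath : ∀ {l u w} → Walk G l u w → Set
  IsPath here                 = ⊤
  IsPath (step {u = u} e p) = ¬ (u ∈ᵥ p) × IsPath p

  ShorterPath : ℕ → Fin (n G) → Fin (n G) → Set
  ShorterPath l u w = ∃[ l′ ] (l′ ≤ l × Σ (Walk G l′ u w) IsPath)

  suffix-path : ∀ {x l u w} (p : Walk G l u w) → x ∈ᵥ p → IsPath p → ShorterPath l x w
  suffix-path here       at-end        _           = 0 , ≤-refl , here , tt
  suffix-path (step e p) at-start      p-path      = _ , ≤-refl , step e p , p-path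
  suffix-path (step e p) (further x∈p) (_ , p-path) with suffix-path p x∈p p-path
  ... | l′ , l′≤l , q , q-path = l′ , m≤n⇒m≤1+n l′≤l , q , q-path

  walk⇒path : ∀ {l u w} → Walk G l u w → ShorterPath l u w
  walk⇒path here = 0 , z≤n , here , tt
  walk⇒path (step {u = u} e p) with walk⇒path p
  ... | l′ , l′≤l , q , q-path with u ∈ᵥ? q
  ...   | no u∉q  = suc l′ , s≤s l′≤l , step e q , u∉q , q-path
  ...   | yes u∈q with suffix-path q u∈q q-path
  ...     | l″ , l″≤l′ , r , r-path = l″ , m≤n⇒m≤1+n (≤-trans l″≤l′ l′≤l) , r , r-path

  vertex : ∀ {l u w} → Walk G l u w → Fin (suc l) → Fin (n G)
  vertex (here {u})          _        = u
  vertex (step {u = u} e p) fzero    = u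
  vertex (step e p)          (fsuc i) = vertex p i

  vertex-∈ᵥ : ∀ {l u w} (p : Walk G l u w) i → vertex p i ∈ᵥ p
  vertex-∈ᵥ here       fzero    = at-end
  vertex-∈ᵥ (step e p) fzero    = at-start
  vertex-∈ᵥ (step e p) (fsuc i) = further (vertex-∈ᵥ p i)

  path⇒vertex-injective : ∀ {l u w} (p : Walk G l u w) → IsPath p → Injective _≡_ _≡_ (vertex p)
  path⇒vertex-injective here       _            {fzero}  {fzero}  _  = refl
  path⇒vertex-injective (step e p) _            {fzero}  {fzero}  _  = refl
  path⇒vertex-injective (step e p) (u∉p , _)    {fzero}  {fsuc j} eq = ⊥-elim (u∉p (subst (_∈ᵥ p) (≡-sym eq) (vertex-∈ᵥ p j)))
  path⇒vertex-injective (step e p) (u∉p , _)    {fsuc i} {fzero}  eq = ⊥-elim (u∉p (subst (_∈ᵥ p) eq (vertex-∈ᵥ p i)))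
  path⇒vertex-injective (step e p) (_ , p-path) {fsuc i} {fsuc j} eq = cong fsuc (path⇒vertex-injective p p-path eq)

  vertex-first : ∀ {l u w} (p : Walk G l u w) (i : Fin (suc l)) → toℕ i ≡ 0 → vertex p i ≡ u
  vertex-first here       fzero _ = refl
  vertex-first (step e p) fzero _ = refl

  vertex-last : ∀ {l u w} (p : Walk G l u w) (i : Fin (suc l)) → toℕ i ≡ l → vertex p i ≡ w
  vertex-last here       fzero    _  = refl
  vertex-last (step e p) (fsuc i) eq = vertex-last p i (suc-injective eq)

  vertex-adjacent : ∀ {l u w} (p : Walk G l u w) (i j : Fin (suc l)) → toℕ j ≡ suc (toℕ i) →
                    Adj G (vertex p i) (vertex p j)
  vertex-adjacent (step e p) fzero    (fsuc j) eq = subst (Adj G _) (≡-sym (vertex-first p j (suc-injective eq))) e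
  vertex-adjacent (step e p) (fsuc i) (fsuc j) eq = vertex-adjacent p i j (suc-injective eq)

successor-mod : ∀ L (i : Fin (suc L)) →
                toℕ (fromℕ< (m%n<n (suc (toℕ i)) (suc L))) ≡ suc (toℕ i) ⊎
                (toℕ i ≡ L × toℕ (fromℕ< (m%n<n (suc (toℕ i)) (suc L))) ≡ 0)
successor-mod L i rewrite toℕ-fromℕ< (m%n<n (suc (toℕ i)) (suc L)) with toℕ i <? L
... | yes i<L = inj₁ (m<n⇒m%n≡m (s≤s i<L))
... | no  i≮L = inj₂ (i≡L , subst (λ t → suc t % suc L ≡ 0) (≡-sym i≡L) (n%n≡0 (suc L)))
  where
  i≡L : toℕ i ≡ L
  i≡L = ≤-antisym (≤-pred (toℕ<n i)) (≮⇒≥ i≮L)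

module _ {H G : Graph} {φ : Fin (n H) → Fin (n G)}
         (φ-inj : Injective _≡_ _≡_ φ) (φ-hom : ∀ {u v} → Adj H u v → Adj G (φ u) (φ v)) where

  path+edge⇒cycle : ∀ {l u w} (p : Walk H (suc (suc l)) u w) → IsPath p → Adj G (φ w) (φ u) →
                    Cycle G (suc (suc (suc l)))
  path+edge⇒cycle {l} p p-path wu = record
    { len≥3 = s≤s (s≤s (s≤s z≤n))
    ; vtx   = φ ∘ vertex p
    ; inj   = path⇒vertex-injective p p-path ∘ φ-inj
    ; adj   = adjacent-to-successor
    }
    where
    adjacent-to-successor : ∀ i → Adj G (φ (vertex p i)) (φ (vertex p (fromℕ< (m%n<n (suc (toℕ i)) (3 + l)))))
    adjacent-to-successor i with successor-mod (suc (suc l)) i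
    ... | inj₁ j≡i+1       = φ-hom (vertex-adjacent p i _ j≡i+1)
    ... | inj₂ (i≡L , j≡0) rewrite vertex-last p i i≡L | vertex-first p _ j≡0 = wu

  non-edge-far : ∀ {k} → GirthGe G (k + 2) →
                 ∀ {x y} → ¬ Adj H x y → Adj G (φ y) (φ x) → ¬ DistLe H x y k
  non-edge-far {k} girth ¬xy yx (l , l≤k , xy-walk) with walk⇒path xy-walk
  ... | 0 , _ , here , _            = irrefl G yx
  ... | 1 , _ , step xy here , _    = ¬xy xy
  ... | suc (suc l′) , l′≤l , p , p-path = 1+n≰n (≤-trans (≤-pred 2+k≤3+l′) (≤-trans l′≤l l≤k))
    where
    2+k≤3+l′ : suc (suc k) ≤ suc (suc (suc l′))
    2+k≤3+l′ = subst (_≤ 3 + l′) (+-comm k 2) (girth _ (path+edge⇒cycle p p-path yx))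

MergesOnly : ∀ {N M} → Fin N → Fin N → (Fin N → Fin M) → Set
MergesOnly u v c = ∀ {x y} → x ≢ y → c x ≡ c y → (x ≡ u × y ≡ v) ⊎ (x ≡ v × y ≡ u)

transpose-injective : ∀ {m} (i j : Fin m) → Injective _≡_ _≡_ (transpose i j)
transpose-injective i j eq =
  trans (≡-sym (transpose-inverse j i)) (trans (cong (transpose j i) eq) (transpose-inverse j i))

transpose-sends : ∀ {m} (i j : Fin m) → transpose i j i ≡ j
transpose-sends i j with i ≟ i
... | yes _   = refl
... | no  i≢i = ⊥-elim (i≢i refl)

merges-∘-injective : ∀ {N M K} {u v : Fin N} {c : Fin N → Fin M} {f : Fin M → Fin K} →
                     Injective _≡_ _≡_ f → MergesOnly u v c → MergesOnly u v (f ∘ c)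
merges-∘-injective f-inj merges x≢y = merges x≢y ∘ f-inj

punchOut-merging : ∀ {m} {u v : Fin (suc m)} (v≢u : v ≢ u) →
                   Σ (Fin (suc m) → Fin m) λ c → c u ≡ punchOut v≢u × c v ≡ punchOut v≢u × MergesOnly u v c
punchOut-merging {u = u} {v} v≢u = c , c-u′ (u ≟ v) , c-v′ (v ≟ v) , λ {x} {y} x≢y → merges x≢y (x ≟ v) (y ≟ v)
  where
  c′ : ∀ x → Dec (x ≡ v) → Fin _
  c′ x (yes _)  = punchOut v≢u
  c′ x (no x≢v) = punchOut (x≢v ∘ ≡-sym)

  c : Fin _ → Fin _
  c x = c′ x (x ≟ v)

  c-u′ : (d : Dec (u ≡ v)) → c′ u d ≡ punchOut v≢u
  c-u′ (yes u≡v) = refl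
  c-u′ (no _)    = refl

  c-v′ : (d : Dec (v ≡ v)) → c′ v d ≡ punchOut v≢u
  c-v′ (yes _)   = refl
  c-v′ (no v≢v) = ⊥-elim (v≢v refl)

  merges : ∀ {x y} → x ≢ y → (dx : Dec (x ≡ v)) (dy : Dec (y ≡ v)) → c′ x dx ≡ c′ y dy →
           (x ≡ u × y ≡ v) ⊎ (x ≡ v × y ≡ u)
  merges x≢y (yes x≡v) (yes y≡v) _  = ⊥-elim (x≢y (trans x≡v (≡-sym y≡v)))
  merges x≢y (yes x≡v) (no _)    eq = inj₂ (x≡v , ≡-sym (punchOut-injective v≢u _ eq))
  merges x≢y (no _)    (yes y≡v) eq = inj₁ (punchOut-injective _ v≢u eq , y≡v)
  merges x≢y (no _)    (no _)    eq = ⊥-elim (x≢y (punchOut-injective {i = v} _ _ eq))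

merging-colouring : ∀ {N} {u v : Fin N} → u ≢ v →
                    Σ (Fin N → Fin (pred N)) λ c → toℕ (c u) ≡ 0 × c v ≡ c u × MergesOnly u v c
merging-colouring {suc zero}    {fzero} {fzero} u≢v = ⊥-elim (u≢v refl)
merging-colouring {suc (suc m)} {u} {v} u≢v with punchOut-merging (u≢v ∘ ≡-sym)
... | c , c-u , c-v , merges =
  transpose i fzero ∘ c , cong toℕ u↦0 , cong (transpose i fzero) (trans c-v (≡-sym c-u)) ,
  merges-∘-injective (transpose-injective i fzero) merges
  where
  i = punchOut (u≢v ∘ ≡-sym)
  u↦0 : transpose i fzero (c u) ≡ fzero
  u↦0 = trans (cong (transpose i fzero) c-u) (transpose-sends i fzero)

s₀≤s : ∀ S i → s S 0 ≤ s S i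
s₀≤s S zero    = ≤-refl
s₀≤s S (suc i) = ≤-trans (s₀≤s S i) (mono S i)

module _ (S : PackingSeq) where

  identity-packing : ∀ G → HasPacking S G (n G)
  identity-packing G = (λ x → x) , λ u v u≢v u≡v → ⊥-elim (u≢v u≡v)

  ChiS-minimal : ∀ {G m m′} → ChiS S G m → HasPacking S G m′ → m ≤ m′
  ChiS-minimal (_ , below-m-impossible) packing = ≮⇒≥ (λ m′<m → below-m-impossible _ m′<m packing)

  packing-injective : ∀ {G m c} → (∀ u v → DistLe G u v (s S 0)) → IsPacking S G m c → Injective _≡_ _≡_ c
  packing-injective {c = c} near packing {x} {y} cx≡cy with x ≟ y | near x y
  ... | yes x≡y | _             = x≡y
  ... | no  x≢y | l , l≤s₀ , xy = ⊥-elim (packing x y x≢y cx≡cy (l , ≤-trans l≤s₀ (s₀≤s S (toℕ (c x))) , xy))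

  order≤ChiS : ∀ {G m} → (∀ u v → DistLe G u v (s S 0)) → ChiS S G m → n G ≤ m
  order≤ChiS near ((_ , packing) , _) = injective⇒≤ (packing-injective near packing)

  merged-packing : ∀ {G u v} → u ≢ v → ¬ DistLe G u v (s S 0) → ¬ DistLe G v u (s S 0) →
                   HasPacking S G (pred (n G))
  merged-packing {G} {u} {v} u≢v u↛v v↛u with merging-colouring u≢v
  ... | c , cu≡0 , cv≡cu , merges = c , packing
    where
    packing : IsPacking S G (pred (n G)) c
    packing x y x≢y cx≡cy with merges x≢y cx≡cy
    ... | inj₁ (refl , refl) = subst (λ j → ¬ DistLe G u v (s S j)) (≡-sym cu≡0) u↛v
    ... | inj₂ (refl , refl) = subst (λ j → ¬ DistLe G v u (s S j)) (≡-sym (trans (cong toℕ cv≡cu) cu≡0)) v↛u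

  missing-edge⇒ChiS<order : ∀ {H G mH} (P : ProperSubgraph H G) → GirthGe G (s S 0 + 2) → ChiS S H mH →
                            ∀ {u v} → ¬ Adj H u v → Adj G (ProperSubgraph.φ P u) (ProperSubgraph.φ P v) → mH < n H
  missing-edge⇒ChiS<order {H} {G} P girth χH {u} {v} ¬uv uv with u ≟ v
  ... | yes refl = ⊥-elim (irrefl G uv)
  ... | no  u≢v  = m≤pred[n]⇒suc[m]≤n {{nonZeroIndex u}} (ChiS-minimal χH (merged-packing u≢v u↛v v↛u))
    where
    open ProperSubgraph P
    u↛v : ¬ DistLe H u v (s S 0)
    u↛v = non-edge-far φ-inj φ-hom girth ¬uv (Graph.sym G uv)
    v↛u : ¬ DistLe H v u (s S 0)
    v↛u = non-edge-far φ-inj φ-hom girth (¬uv ∘ Graph.sym H) uv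

injective⇒surjective : ∀ {m N} {f : Fin m → Fin N} → Injective _≡_ _≡_ f → N ≤ m → Surjective _≡_ _≡_ f
injective⇒surjective {m} {suc N} {f} f-inj N≤m y with any? (λ x → f x ≟ y)
... | yes (x , fx≡y) = x , λ { refl → fx≡y }
... | no  y∉image    = ⊥-elim (1+n≰n (≤-trans N≤m (injective⇒≤ f-avoiding-y-injective)))
  where
  f-avoiding-y : Fin m → Fin N
  f-avoiding-y x = punchOut {i = y} (λ y≡fx → y∉image (x , ≡-sym y≡fx))
  f-avoiding-y-injective : Injective _≡_ _≡_ f-avoiding-y
  f-avoiding-y-injective eq = f-inj (punchOut-injective {i = y} _ _ eq)

¬¬-→ : ∀ {A B : Set} → (A → ¬ ¬ B) → ¬ ¬ (A → B)
¬¬-→ f ¬[A→B] = ¬[A→B] (λ a → ⊥-elim (f a (λ b → ¬[A→B] (λ _ → b))))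

¬¬-∀-Fin : ∀ {N} {P : Fin N → Set} → (∀ i → ¬ ¬ P i) → ¬ ¬ (∀ i → P i)
¬¬-∀-Fin {zero}          _     ¬∀ = ¬∀ λ ()
¬¬-∀-Fin {suc N} {P} ¬¬P ¬∀ =
  ¬¬P fzero λ P₀ → ¬¬-∀-Fin {P = P ∘ fsuc} (¬¬P ∘ fsuc) λ P₊ → ¬∀ λ { fzero → P₀ ; (fsuc i) → P₊ i }

-- Adjacency is not decidable, so the missing edge exists only under ¬ ¬; the goal is decidable.
corollary3p4 : (k : ℕ) → 1 ≤ k → (S : PackingSeq) → s S 0 ≡ k →
               (G : Graph) → DiamEq G k → GirthGe G (k + 2) →
               Critical S G
corollary3p4 _ _ S refl G (near , _) girth H P _ mG mH χG χH =
  decidable-stable (mH <? mG) (λ mH≮mG → n[G]≤χ[H]-absurd (≤-trans (order≤ChiS S near χG) (≮⇒≥ mH≮mG)))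
  where
  open ProperSubgraph P

  n[G]≤χ[H]-absurd : n G ≤ mH → ⊥
  n[G]≤χ[H]-absurd nG≤mH with n H <? n G
  ... | yes nH<nG = <⇒≱ (<-≤-trans nH<nG nG≤mH) (ChiS-minimal S χH (identity-packing S H))
  ... | no  nH≮nG = ¬¬-∀-Fin (λ u → ¬¬-∀-Fin (λ v → ¬¬-→ (edge-reflected u v)))
                             (λ reflects → proper (injective⇒surjective φ-inj (≮⇒≥ nH≮nG) , reflects))
    where
    edge-reflected : ∀ u v → Adj G (φ u) (φ v) → ¬ ¬ Adj H u v
    edge-reflected u v uv ¬uv =
      <⇒≱ (missing-edge⇒ChiS<order S P girth χH ¬uv uv) (≤-trans (injective⇒≤ φ-inj) nG≤mH)
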